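{- If there is a pair $(i,j)$ with $l_i=l'_j\ne0$, then for every $t\in\frac{n+m}{2}+\mathbb{Z}$ either $t$ is a pole of $\Gamma_{\mathbb{R}}(s-\kappa')\Gamma_{\mathbb{R}}(s-\kappa'+1)$ or $t$ is a pole of $\Gamma_{\mathbb{R}}(1-s+\kappa')\Gamma_{\mathbb{R}}(1-s+\kappa'+1)$; hence $t$ is a pole of $L(s,\tau)$ or of $L(1-s,\check\tau)$. In particular the set of critical numbers is empty in this case.
   Context: For $N\ge1$ let $L_0^+(N)$ be the set of $(w,l)\in\mathbb{Z}\times\mathbb{Z}^N$ with $l_1>\dots>l_N$, $l_i+l_{N+1-i}=0$ and $w+l_i\equiv N+1\bmod2$. Fix $n,m\ge1$, $(w,l)\in L_0^+(n)$, $(w',l')\in L_0^+(m)$, $\delta,\delta'\in\{0,1\}$. In Knapp's notation for $W_{\mathbb{R}}$, $(l,t)$ ($l\ge1$) is irreducible $2$-dimensional and $(\mathrm{sgn}^\epsilon,t)$ is $1$-dimensional, $L(s,(l,t))=\Gamma_{\mathbb{C}}(s+t+\frac l2)$, $L(s,(\mathrm{sgn}^\epsilon,t))=\Gamma_{\mathbb{R}}(s+t+\epsilon)$, $\Gamma_{\mathbb{R}}(s)=\pi^{ -s/2}\Gamma(s/2)$, $\Gamma_{\mathbb{C}}(s)=2(2\pi)^{ -s}\Gamma(s)$; $L$-functions are multiplicative over irreducible constituents, and tensor products decompose via $(l,t)\otimes(l',t')=(l+l',t+t')\oplus(|l-l'|,t+t')$ where $(0,t):=(\mathrm{sgn}^0,t)\oplus(\mathrm{sgn}^1,t)$,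 $(l,t)\otimes(\mathrm{sgn}^\epsilon,t')=(l,t+t')$, $(\mathrm{sgn}^\epsilon,t)\otimes(\mathrm{sgn}^{\epsilon'},t')=(\mathrm{sgn}^{\epsilon+\epsilon'},t+t')$. $\pi_\infty^W=\bigoplus_{i\le n/2}(l_i,-w/2)$ plus $(\mathrm{sgn}^\delta,-w/2)$ if $n$ odd; $\sigma_\infty^W$ analogously; $\tau=\pi_\infty^W\otimes\sigma_\infty^W$, $\check\tau$ its contragredient. $t\in\frac{n+m}{2}+\mathbb{Z}$ is critical if neither $L(s,\tau)$ nor $L(1-s,\check\tau)$ has a pole at $s=t$. $\kappa'=\frac12(w+w')$. -}

module Defs where

open import Data.Nat as ℕ using (ℕ; zero; suc; _≤?_)
open import Data.Integer as ℤ using (ℤ; +_; -_; _-_; ∣_∣)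
open import Data.Integer.Divisibility using (_∣_)
open import Data.Fin using (Fin; toℕ; opposite) renaming (_<_ to _<ᶠ_)
open import Data.Bool using (Bool; true; false; if_then_else_; _xor_)
open import Data.List using (List; []; _∷_; _++_; map; filter; concatMap)
open import Data.List.Relation.Unary.Any using (Any)
open import Data.Fin.Base using () 
open import Data.List using () renaming (allFin to allFinL)
open import Data.Product using (∃; _×_)
open import Relation.Binary.PropositionalEquality using (_≡_)
open import Relation.Nullary using (¬_)

-- CONVENTION: half-integers x are represented by their doubles 2x : ℤ.
-- Signs sgn^ε, ε ∈ {0,1}, are represented by Bool (false = 0, true = 1).

bit : Bool → ℤ
bit false = + 0
bit true  = + 1

-- (w,l) ∈ L_0^+(N), with l : Fin N → ℤ (0-based: l i is l_{i+1})
record L0+ (N : ℕ) (w : ℤ) (l : Fin N → ℤ) : Set where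
  field
    decreasing : ∀ i j → i <ᶠ j → l j ℤ.< l i
    antisym    : ∀ i → l i ℤ.+ l (opposite i) ≡ + 0
    parity     : ∀ i → + 2 ∣ (w ℤ.+ l i - + suc N)

-- Irreducible representations of W_ℝ (Knapp):
--   two l T  =  (l, T/2)          (2-dimensional, l ≥ 1)
--   one ε T  =  (sgn^ε, T/2)      (1-dimensional)
data Irr : Set where
  two : ℕ → ℤ → Irr
  one : Bool → ℤ → Irr

Rep : Set
Rep = List Irr

-- (l,t) with the convention (0,t) := (sgn^0,t) ⊕ (sgn^1,t)
twoOrZero : ℕ → ℤ → Rep
twoOrZero zero    T = one false T ∷ one true T ∷ []
twoOrZero (suc l) T = two (suc l) T ∷ []

tensorIrr : Irr → Irr → Rep
tensorIrr (two l T) (two l′ T′) = twoOrZero (l ℕ.+ l′) (T ℤ.+ T′) ++ twoOrZero ℕ.∣ l - l′ ∣ (T ℤ.+ T′)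
tensorIrr (two l T) (one ε′ T′) = two l (T ℤ.+ T′) ∷ []
tensorIrr (one ε T) (two l′ T′) = two l′ (T ℤ.+ T′) ∷ []
tensorIrr (one ε T) (one ε′ T′) = one (ε xor ε′) (T ℤ.+ T′) ∷ []

tensor : Rep → Rep → Rep
tensor ρ σ = concatMap (λ r → concatMap (λ s → tensorIrr r s) σ) ρ

dualIrr : Irr → Irr
dualIrr (two l T) = two l (- T)
dualIrr (one ε T) = one ε (- T)

dual : Rep → Rep
dual = map dualIrr

-- Γ_ℝ has a pole at x iff x ∈ {0,-2,-4,…}; argument given doubled (X = 2x)
ΓℝPole : ℤ → Set
ΓℝPole X = ∃ λ (k : ℕ) → X ≡ - (+ (4 ℕ.* k))

-- Γ_ℂ has a pole at x iff x ∈ {0,-1,-2,…}; argument given doubled (X = 2x)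
ΓℂPole : ℤ → Set
ΓℂPole X = ∃ λ (k : ℕ) → X ≡ - (+ (2 ℕ.* k))

-- L(s,ρ) has a pole at s (S = 2s), for ρ irreducible:
--   L(s,(l,t)) = Γ_ℂ(s+t+l/2),  L(s,(sgn^ε,t)) = Γ_ℝ(s+t+ε)
IrrPole : Irr → ℤ → Set
IrrPole (two l T) S = ΓℂPole (S ℤ.+ T ℤ.+ + l)
IrrPole (one ε T) S = ΓℝPole (S ℤ.+ T ℤ.+ + 2 ℤ.* bit ε)

LPole : Rep → ℤ → Set
LPole ρ S = Any (λ r → IrrPole r S) ρ

-- s ↦ L(1-s, ρˇ) has a pole at s = t (T = 2t)
LDualPole : Rep → ℤ → Set
LDualPole ρ T = LPole (dual ρ) (+ 2 - T)

Critical : Rep → ℤ → Set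
Critical ρ T = ¬ LPole ρ T × ¬ LDualPole ρ T

isOdd : ℕ → Bool
isOdd zero          = false
isOdd (suc zero)    = true
isOdd (suc (suc n)) = isOdd n

-- π_∞^W = ⊕_{1 ≤ i ≤ n/2} (l_i, -w/2)  ⊕ (sgn^δ, -w/2) if n odd
piW : (n : ℕ) → ℤ → (Fin n → ℤ) → Bool → Rep
piW n w l δ =
  map (λ i → two ∣ l i ∣ (- w)) (filter (λ i → 2 ℕ.* suc (toℕ i) ≤? n) (allFinL n))
  ++ (if isOdd n then one δ (- w) ∷ [] else [])

-- By the symmetry l_{N+1-i} = -l_i the common value |l_i| = |l'_j| ≠ 0 occurs in both π_∞^W
-- and σ_∞^W; hence τ ⊇ (|l_i|, -w/2) ⊗ (|l_i|, -w'/2) ⊇ (0, -κ') = (sgn⁰, -κ') ⊕ (sgn¹, -κ'), so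
-- Γℝ(s-κ')Γℝ(s-κ'+1) = Γℂ(s-κ') divides L(s,τ), and dually for L(1-s,τˇ).  The parity
-- conditions on (w,l), (w',l') make t - κ' an integer, and for an integer x either x ≤ 0
-- or 1 - x ≤ 0, so Γℂ(s-κ') or Γℂ(1-s+κ') has a pole at s = t.
module Submission where

open import Defs
open import Data.Nat using (ℕ; _≥_)
open import Data.Integer using (ℤ; +_; _+_; _-_)
open import Data.Integer.Divisibility using (_∣_)
open import Data.Fin using (Fin)
open import Data.Bool using (Bool)
open import Data.Product using (∃; ∃₂; _×_)
open import Data.Sum using (_⊎_)
open import Relation.Binary.PropositionalEquality using (_≡_; _≢_)
open import Relation.Nullary using (¬_)

open import Data.Nat as ℕ using (zero; suc; _≤?_)
import Data.Nat.Properties as ℕ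
open import Data.Integer using (-[1+_]; _*_; -_; ∣_∣)
open import Data.Integer.Properties
  using (+-0-abelianGroup; pos-+; pos-*; neg-distrib-+; neg-involutive; +-identityʳ; ∣-i∣≡∣i∣)
open import Algebra.Bundles using (AbelianGroup)
open import Algebra.Properties.Group (AbelianGroup.group +-0-abelianGroup) using (inverseʳ-unique)
import Data.Integer.Divisibility.Signed as Signed
open import Data.Integer.Divisibility.Signed
  using (divides; ∣ᵤ⇒∣; ∣m∣n⇒∣m+n; ∣m∣n⇒∣m-n; ∣m⇒∣m*n; ∣-refl)
open import Data.Integer.Tactic.RingSolver using (solve-∀)
import Data.Nat.Tactic.RingSolver as ℕ-Solver
open import Data.Fin using (toℕ; opposite)
open import Data.Fin.Properties using (opposite-prop; opposite-involutive; toℕ-injective; toℕ<n)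
open import Data.Bool using (true; false)
open import Data.Product using (_,_)
open import Data.Sum using (inj₁; inj₂; [_,_]′)
import Data.Sum as Sum
open import Data.List.Membership.Propositional using (_∈_; lose)
open import Data.List.Membership.Propositional.Properties
  using (∈-filter⁺; ∈-allFin; ∈-map⁺; ∈-++⁺ˡ; ∈-++⁺ʳ)
open import Data.List.Relation.Unary.Any using (here; there)
open import Data.List.Relation.Unary.Any.Properties using (concatMap⁺)
open import Data.Empty using (⊥-elim)
open import Relation.Binary.Definitions using (tri<; tri≈; tri>)
open import Relation.Binary.PropositionalEquality using (refl; sym; trans; cong; subst; module ≡-Reasoning)

ΓℝΓℝPole : ℤ → Set
ΓℝΓℝPole X = ΓℝPole X ⊎ ΓℝPole (X + + 2)

even⊎odd : ∀ k → ∃ λ a → k ≡ a ℕ.+ a ⊎ k ≡ suc (a ℕ.+ a)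
even⊎odd zero = 0 , inj₁ refl
even⊎odd (suc k) with even⊎odd k
... | a , inj₁ refl = a , inj₂ refl
... | a , inj₂ refl = suc a , inj₁ (cong suc (sym (ℕ.+-suc a a)))

-- Γℂ(x) = Γℝ(x)Γℝ(x+1)
ΓℂPole⇒ΓℝΓℝPole : ∀ {X} → ΓℂPole X → ΓℝΓℝPole X
ΓℂPole⇒ΓℝΓℝPole (k , refl) with even⊎odd k
... | a , inj₁ refl = inj₁ (a , cong (λ x → - + x) (2[a+a]≡4a a))
  where
  2[a+a]≡4a : ∀ a → 2 ℕ.* (a ℕ.+ a) ≡ 4 ℕ.* a
  2[a+a]≡4a = ℕ-Solver.solve-∀
... | a , inj₂ refl = inj₂ (a , -2[1+a+a]+2≡-4a)
  where
  open ≡-Reasoning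
  2[1+a+a]≡4a+2 : ∀ a → 2 ℕ.* suc (a ℕ.+ a) ≡ 4 ℕ.* a ℕ.+ 2
  2[1+a+a]≡4a+2 = ℕ-Solver.solve-∀
  -[x+2]+2≡-x : ∀ x → - (x + + 2) + + 2 ≡ - x
  -[x+2]+2≡-x = solve-∀
  -2[1+a+a]+2≡-4a : - + (2 ℕ.* suc (a ℕ.+ a)) + + 2 ≡ - + (4 ℕ.* a)
  -2[1+a+a]+2≡-4a = begin
    - + (2 ℕ.* suc (a ℕ.+ a)) + + 2  ≡⟨ cong (λ x → - + x + + 2) (2[1+a+a]≡4a+2 a) ⟩
    - + (4 ℕ.* a ℕ.+ 2) + + 2        ≡⟨ cong (λ x → - x + + 2) (pos-+ (4 ℕ.* a) 2) ⟩
    - (+ (4 ℕ.* a) + + 2) + + 2      ≡⟨ -[x+2]+2≡-x (+ (4 ℕ.* a)) ⟩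
    - + (4 ℕ.* a)                    ∎

-- Every even X satisfies X ≤ 0 or 2 - X ≤ 0.
even⇒ΓℂPole⊎ΓℂPole[2-] : ∀ {X} → + 2 Signed.∣ X → ΓℂPole X ⊎ ΓℂPole (+ 2 - X)
even⇒ΓℂPole⊎ΓℂPole[2-] (divides (+ zero) refl) = inj₁ (0 , refl)
even⇒ΓℂPole⊎ΓℂPole[2-] (divides -[1+ q ] refl) =
  inj₁ (suc q , trans (-a*2≡-[2*a] (+ suc q)) (cong -_ (sym (pos-* 2 (suc q)))))
  where
  -a*2≡-[2*a] : ∀ a → - a * + 2 ≡ - (+ 2 * a)
  -a*2≡-[2*a] = solve-∀
even⇒ΓℂPole⊎ΓℂPole[2-] (divides (+ suc q) refl) =
  inj₂ (q , trans (2-[1+a]*2≡-[2*a] (+ q)) (cong -_ (sym (pos-* 2 q))))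
  where
  2-[1+a]*2≡-[2*a] : ∀ a → + 2 - (+ 1 + a) * + 2 ≡ - (+ 2 * a)
  2-[1+a]*2≡-[2*a] = solve-∀

even⇒ΓℝΓℝPole⊎ΓℝΓℝPole[2-] : ∀ T K → + 2 Signed.∣ (T - K) →
  ΓℝΓℝPole (T - K) ⊎ ΓℝΓℝPole (+ 2 - T + K)
even⇒ΓℝΓℝPole⊎ΓℝΓℝPole[2-] T K 2∣T-K =
  Sum.map ΓℂPole⇒ΓℝΓℝPole (λ p → ΓℂPole⇒ΓℝΓℝPole (subst ΓℂPole (2-[T-K]≡2-T+K T K) p))
    (even⇒ΓℂPole⊎ΓℂPole[2-] 2∣T-K)
  where
  2-[T-K]≡2-T+K : ∀ T K → + 2 - (T - K) ≡ + 2 - T + K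
  2-[T-K]≡2-T+K = solve-∀

sgnPair∈⇒LPole : ∀ {ρ U S} → one false U ∈ ρ → one true U ∈ ρ → ΓℝΓℝPole (S + U) → LPole ρ S
sgnPair∈⇒LPole sgn⁰∈ρ sgn¹∈ρ (inj₁ p) = lose sgn⁰∈ρ (subst ΓℝPole (sym (+-identityʳ _)) p)
sgnPair∈⇒LPole sgn⁰∈ρ sgn¹∈ρ (inj₂ p) = lose sgn¹∈ρ p

sgnPair∈⇒LDualPole : ∀ {ρ K T} → one false (- K) ∈ ρ → one true (- K) ∈ ρ →
  ΓℝΓℝPole (+ 2 - T + K) → LDualPole ρ T
sgnPair∈⇒LDualPole {ρ} {K} sgn⁰∈ρ sgn¹∈ρ =
  sgnPair∈⇒LPole (sgn∈dual sgn⁰∈ρ) (sgn∈dual sgn¹∈ρ)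
  where
  sgn∈dual : ∀ {ε} → one ε (- K) ∈ ρ → one ε K ∈ dual ρ
  sgn∈dual {ε} sgn∈ρ = subst (λ V → one ε V ∈ dual ρ) (neg-involutive K) (∈-map⁺ dualIrr sgn∈ρ)

i+i≡0⇒i≡0 : ∀ i → i + i ≡ + 0 → i ≡ + 0
i+i≡0⇒i≡0 (+ zero) _ = refl

<opposite⇒inFirstHalf : ∀ {N} (i : Fin N) → toℕ i ℕ.< toℕ (opposite i) → 2 ℕ.* suc (toℕ i) ℕ.≤ N
<opposite⇒inFirstHalf {N} i i<opp-i =
  subst (ℕ._≤ N) (sym (cong (suc (toℕ i) ℕ.+_) (ℕ.+-identityʳ (suc (toℕ i)))))
    (ℕ.m≤o∸n⇒m+n≤o (suc (toℕ i)) (toℕ<n i) (subst (suc (toℕ i) ℕ.≤_) (opposite-prop i) i<opp-i))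

∣l∣-inFirstHalf : ∀ {N} (l : Fin N → ℤ) → (∀ i → l i + l (opposite i) ≡ + 0) → ∀ i → l i ≢ + 0 →
  ∃ λ i′ → 2 ℕ.* suc (toℕ i′) ℕ.≤ N × ∣ l i′ ∣ ≡ ∣ l i ∣
∣l∣-inFirstHalf l antisym i l-i≢0 with ℕ.<-cmp (toℕ i) (toℕ (opposite i))
... | tri< i<opp-i _ _ = i , <opposite⇒inFirstHalf i i<opp-i , refl
... | tri≈ _ i≡opp-i _ = ⊥-elim (l-i≢0 (i+i≡0⇒i≡0 (l i) l-i+l-i≡0))
  where
  l-i+l-i≡0 : l i + l i ≡ + 0
  l-i+l-i≡0 = subst (λ j → l i + l j ≡ + 0) (toℕ-injective (sym i≡opp-i)) (antisym i)
... | tri> _ _ opp-i<i = opposite i , <opposite⇒inFirstHalf (opposite i) opp-i<opp-opp-i , ∣l-opp-i∣≡∣l-i∣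
  where
  opp-i<opp-opp-i : toℕ (opposite i) ℕ.< toℕ (opposite (opposite i))
  opp-i<opp-opp-i = subst (λ j → toℕ (opposite i) ℕ.< toℕ j) (sym (opposite-involutive i)) opp-i<i
  ∣l-opp-i∣≡∣l-i∣ : ∣ l (opposite i) ∣ ≡ ∣ l i ∣
  ∣l-opp-i∣≡∣l-i∣ = trans (cong ∣_∣ (inverseʳ-unique (l i) (l (opposite i)) (antisym i))) (∣-i∣≡∣i∣ (l i))

two∣l∣∈piW : ∀ {N w} {l : Fin N → ℤ} δ → L0+ N w l → ∀ i → l i ≢ + 0 → two ∣ l i ∣ (- w) ∈ piW N w l δ
two∣l∣∈piW {N} {w} {l} δ L i l-i≢0 with ∣l∣-inFirstHalf l (L0+.antisym L) i l-i≢0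
... | i′ , i′-inFirstHalf , ∣l-i′∣≡∣l-i∣ =
  subst (λ a → two a (- w) ∈ piW N w l δ) ∣l-i′∣≡∣l-i∣
    (∈-++⁺ˡ (∈-map⁺ _ (∈-filter⁺ (λ k → 2 ℕ.* suc (toℕ k) ≤? N) (∈-allFin i′) i′-inFirstHalf)))

-- (a, t) ⊗ (a, t′) contains (|a - a|, t + t′) = (0, t + t′) = (sgn⁰, t + t′) ⊕ (sgn¹, t + t′).
sgn∈tensor : ∀ {ρ σ a U U′} ε → two a U ∈ ρ → two a U′ ∈ σ → one ε (U + U′) ∈ tensor ρ σ
sgn∈tensor {a = a} {U} {U′} ε two-a-U∈ρ two-a-U′∈σ =
  concatMap⁺ _ (lose two-a-U∈ρ (concatMap⁺ (tensorIrr (two a U)) (lose two-a-U′∈σ sgn∈tensorIrr)))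
  where
  sgn∈twoOrZero0 : ∀ ε → one ε (U + U′) ∈ twoOrZero 0 (U + U′)
  sgn∈twoOrZero0 false = here refl
  sgn∈twoOrZero0 true  = there (here refl)
  sgn∈tensorIrr : one ε (U + U′) ∈ tensorIrr (two a U) (two a U′)
  sgn∈tensorIrr = ∈-++⁺ʳ (twoOrZero (a ℕ.+ a) (U + U′))
    (subst (λ k → one ε (U + U′) ∈ twoOrZero k (U + U′)) (sym (ℕ.∣n-n∣≡0 a)) (sgn∈twoOrZero0 ε))

2∣T-n-m⇒2∣T-w-w′ : ∀ n m w w′ x T → + 2 Signed.∣ (w + x - + suc n) → + 2 Signed.∣ (w′ + x - + suc m) →
  + 2 Signed.∣ (T - + (n ℕ.+ m)) → + 2 Signed.∣ (T - (w + w′))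
2∣T-n-m⇒2∣T-w-w′ n m w w′ x T 2∣w+x-n-1 2∣w′+x-m-1 2∣T-n-m =
  subst (+ 2 Signed.∣_) (sym (regroup T w w′ x (+ n) (+ m)))
    (∣m∣n⇒∣m+n (∣m∣n⇒∣m-n (∣m∣n⇒∣m-n 2∣T-n-m 2∣w+x-n-1) 2∣w′+x-m-1) (∣m⇒∣m*n (x - + 1) ∣-refl))
  where
  regroup : ∀ T w w′ x N M →
    T - (w + w′) ≡ (T - (N + M)) - (w + x - (+ 1 + N)) - (w′ + x - (+ 1 + M)) + + 2 * (x - + 1)
  regroup = solve-∀

lemma2p4 : (n m : ℕ) → n ≥ 1 → m ≥ 1
    → (w : ℤ) (l : Fin n → ℤ) → L0+ n w l
    → (w′ : ℤ) (l′ : Fin m → ℤ) → L0+ m w′ l′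
    → (δ δ′ : Bool)
    → ∃₂ (λ i j → l i ≡ l′ j × l i ≢ + 0)
    → let τ = tensor (piW n w l δ) (piW m w′ l′ δ′)
          K = w + w′
      in (∀ (T : ℤ) → + 2 ∣ (T - + (n Data.Nat.+ m))
            → ((ΓℝPole (T - K) ⊎ ΓℝPole (T - K + + 2))
                 ⊎ (ΓℝPole (+ 2 - T + K) ⊎ ΓℝPole (+ 2 - T + K + + 2)))
              × (LPole τ T ⊎ LDualPole τ T))
         × (∀ (T : ℤ) → + 2 ∣ (T - + (n Data.Nat.+ m)) → ¬ Critical τ T)
lemma2p4 n m _ _ w l L w′ l′ L′ δ δ′ (i , j , l-i≡l′-j , l-i≢0) =
  (λ T 2∣T-n-m → cover T 2∣T-n-m , poles T (cover T 2∣T-n-m)) ,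
  (λ T 2∣T-n-m (¬LPole , ¬LDualPole) → [ ¬LPole , ¬LDualPole ]′ (poles T (cover T 2∣T-n-m)))
  where
  τ = tensor (piW n w l δ) (piW m w′ l′ δ′)
  K = w + w′
  two∈π : two ∣ l i ∣ (- w) ∈ piW n w l δ
  two∈π = two∣l∣∈piW δ L i l-i≢0
  two∈σ : two ∣ l i ∣ (- w′) ∈ piW m w′ l′ δ′
  two∈σ = subst (λ x → two ∣ x ∣ (- w′) ∈ piW m w′ l′ δ′) (sym l-i≡l′-j)
    (two∣l∣∈piW δ′ L′ j (λ l′-j≡0 → l-i≢0 (trans l-i≡l′-j l′-j≡0)))
  sgn∈τ : ∀ ε → one ε (- K) ∈ τ
  sgn∈τ ε = subst (λ U → one ε U ∈ τ) (sym (neg-distrib-+ w w′)) (sgn∈tensor ε two∈π two∈σ)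
  cover : ∀ T → + 2 ∣ (T - + (n ℕ.+ m)) → ΓℝΓℝPole (T - K) ⊎ ΓℝΓℝPole (+ 2 - T + K)
  cover T 2∣T-n-m = even⇒ΓℝΓℝPole⊎ΓℝΓℝPole[2-] T K (2∣T-n-m⇒2∣T-w-w′ n m w w′ (l i) T
    (∣ᵤ⇒∣ (L0+.parity L i))
    (∣ᵤ⇒∣ (subst (λ x → + 2 ∣ (w′ + x - + suc m)) (sym l-i≡l′-j) (L0+.parity L′ j)))
    (∣ᵤ⇒∣ 2∣T-n-m))
  poles : ∀ T → ΓℝΓℝPole (T - K) ⊎ ΓℝΓℝPole (+ 2 - T + K) → LPole τ T ⊎ LDualPole τ T
  poles T = Sum.map (sgnPair∈⇒LPole (sgn∈τ false) (sgn∈τ true))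
                    (sgnPair∈⇒LDualPole {T = T} (sgn∈τ false) (sgn∈τ true))
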